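{- Suppose that $f(x)$ is the $f$-polynomial of a flag simplicial complex. Then for every positive integer $m$, there exists a flag simplicial complex whose $f$-polynomial is $f(mx)$.
   Context: A simplicial complex is flag if all its minimal non-faces have exactly two elements. The $f$-polynomial of a simplicial complex $\Delta$ is $\sum_{F\in\Delta}x^{|F|}$ (the empty face contributes $1$). -}

module Defs where

open import Data.Nat using (ℕ; zero; suc; _+_; _*_; _^_)
open import Data.Bool using (Bool; true; false; _∧_; if_then_else_)
open import Data.List using (List; []; _∷_; _++_; map; length; filter)
open import Data.Vec using (Vec; []; _∷_)
open import Data.Fin.Subset using (Subset; inside; outside; ⊥; _⊆_; _⊂_; ∣_∣)
open import Relation.Binary.PropositionalEquality using (_≡_)
open import Relation.Nullary using (¬_)
open import Data.Nat using (_≡ᵇ_)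

allSubsets : (n : ℕ) → List (Subset n)
allSubsets zero = [] ∷ []
allSubsets (suc n) = map (inside ∷_) (allSubsets n) ++ map (outside ∷_) (allSubsets n)

record SimplicialComplex (n : ℕ) : Set where
  field
    face       : Subset n → Bool
    empty-face : face ⊥ ≡ true
    down-closed : ∀ {F G} → G ⊆ F → face F ≡ true → face G ≡ true
open SimplicialComplex public

MinimalNonFace : ∀ {n} → SimplicialComplex n → Subset n → Set
MinimalNonFace Δ F = (face Δ F ≡ false) × (∀ G → G ⊂ F → face Δ G ≡ true)
  where open import Data.Product using (_×_)

IsFlag : ∀ {n} → SimplicialComplex n → Set
IsFlag Δ = ∀ F → MinimalNonFace Δ F → ∣ F ∣ ≡ 2

-- f_k(Δ): the number of faces of Δ with exactly k elements,
-- i.e. the coefficient of x^k in the f-polynomial Σ_{F∈Δ} x^{|F|}.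
fCoeff : ∀ {n} → SimplicialComplex n → ℕ → ℕ
fCoeff {n} Δ k = length (filter (λ F → Data.Bool._≟_ (face Δ F ∧ (∣ F ∣ ≡ᵇ k)) true) (allSubsets n))
  where import Data.Bool

-- f-polynomial of Δ equals f(m x), where f is the f-polynomial of Γ:
-- coefficientwise, f_k(Δ) = m^k f_k(Γ) for all k.
HasFPolyScaled : ∀ {n n'} → SimplicialComplex n' → ℕ → SimplicialComplex n → Set
HasFPolyScaled Δ m Γ = ∀ k → fCoeff Δ k ≡ m ^ k * fCoeff Γ k

module Submission where

-- Given a complex Γ on n vertices and m ≥ 0,
-- replace every vertex i of Γ by a block of m pairwise non-adjacent copies.
-- On the vertex set Fin (n * m), read as n consecutive blocks of size m,
-- a set G is a face of the inflation Δ iff G is a *transversal* (it meets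
-- every block at most once) and its *shadow* (the set of blocks it meets)
-- is a face of Γ.
--
--  * Counting: a k-face of Γ has exactly m^k transversal lifts, so
--    f_k(Δ) = m^k f_k(Γ).  We count k-subsets through the Pascal recursion
--    on the first coordinate ('sized'); peeling off one block of size m
--    ('blockThen', 'count-block-suc') gives the factor m per element.
--  * Flagness: a minimal non-face of Δ is either not a transversal, and then
--    it is a pair of vertices in one block, or it is a transversal whose
--    shadow is a minimal non-face of Γ ('shadow-minimal'), of the same size.

open import Defs
open import Function using (_∘_)
open import Data.Nat using (ℕ; zero; suc; _+_; _*_; _^_; _≤_; _≡ᵇ_)
open import Data.Nat.Properties
  using (+-identityʳ; *-identityˡ; *-zeroʳ; *-assoc; *-distribˡ-+; +-comm; +-commutativeSemigroup)
open import Algebra.Properties.CommutativeSemigroup +-commutativeSemigroup using (x∙yz≈y∙xz)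
open import Data.Product using (Σ; ∃; _×_; _,_)
open import Data.Bool using (Bool; true; false; _∧_; _∨_; not; if_then_else_)
import Data.Bool as Bool
open import Data.Bool.Properties
  using (∧-assoc; ∧-zeroʳ; ∧-conicalˡ; ∧-conicalʳ; ≤-refl; ≤-minimum; ≤-maximum; not-involutive)
open import Data.List using (List; []; _∷_; _++_; map; length; filter)
open import Data.List.Properties using (length-++; filter-++)
open import Data.Vec using (Vec; []; _∷_; take; drop; here) renaming (_++_ to _++ᵛ_)
open import Data.Vec.Properties using (≡-dec; take++drop≡id)
open import Data.Vec.Relation.Binary.Pointwise.Inductive
  using (Pointwise; []; _∷_; ++⁺) renaming (refl to Pointwise-refl; head to ⊑-head; tail to ⊑-tail)
open import Data.Fin.Subset using (Subset; inside; outside; ⊥; _⊆_; _⊂_; ∣_∣)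
open import Data.Fin.Subset.Properties
  using (drop-∷-⊆; out⊆; s⊆s; out⊂; out⊂in; in⊂in; ⊥⊆; ∣⊥∣≡0; ⊂-irref; p⊂q⇒p⊆q)
open import Relation.Binary.PropositionalEquality
open import Relation.Nullary using (yes; no; contradiction)

∧-true : ∀ {x y} → x ≡ true → y ≡ true → x ∧ y ≡ true
∧-true refl refl = refl

not-true : ∀ {x} → not x ≡ true → x ≡ false
not-true {x} e = trans (sym (not-involutive x)) (cong not e)

not-false : ∀ {x} → not x ≡ false → x ≡ true
not-false {x} e = trans (sym (not-involutive x)) (cong not e)

≤-false : ∀ {x y} → x Bool.≤ y → y ≡ false → x ≡ false
≤-false Bool.b≤b e = e

-- Inclusion of subsets as the pointwise order false ≤ true; being
-- inductive, it is the convenient form of '⊆' for structural recursion.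

_⊑_ : ∀ {n} → Subset n → Subset n → Set
_⊑_ = Pointwise Bool._≤_

⊑-refl : ∀ {n} {p : Subset n} → p ⊑ p
⊑-refl = Pointwise-refl ≤-refl

⊆⇒⊑ : ∀ {n} {p q : Subset n} → p ⊆ q → p ⊑ q
⊆⇒⊑ {p = []} {[]} _ = []
⊆⇒⊑ {p = outside ∷ p} {y ∷ q} p⊆q = ≤-minimum y ∷ ⊆⇒⊑ (drop-∷-⊆ p⊆q)
⊆⇒⊑ {p = inside ∷ p} {inside ∷ q} p⊆q = Bool.b≤b ∷ ⊆⇒⊑ (drop-∷-⊆ p⊆q)
⊆⇒⊑ {p = inside ∷ p} {outside ∷ q} p⊆q with p⊆q here
... | ()

⊑⇒⊆ : ∀ {n} {p q : Subset n} → p ⊑ q → p ⊆ q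
⊑⇒⊆ [] x∈p = x∈p
⊑⇒⊆ (Bool.f≤t ∷ p⊑q) = out⊆ (⊑⇒⊆ p⊑q)
⊑⇒⊆ (Bool.b≤b ∷ p⊑q) = s⊆s (⊑⇒⊆ p⊑q)

⊑∧≢⇒⊂ : ∀ {n} {p q : Subset n} → p ⊑ q → p ≢ q → p ⊂ q
⊑∧≢⇒⊂ [] p≢q = contradiction refl p≢q
⊑∧≢⇒⊂ (Bool.f≤t ∷ p⊑q) _ = out⊂in (⊑⇒⊆ p⊑q)
⊑∧≢⇒⊂ (Bool.b≤b {false} ∷ p⊑q) p≢q = out⊂ (⊑∧≢⇒⊂ p⊑q (p≢q ∘ cong (outside ∷_)))
⊑∧≢⇒⊂ (Bool.b≤b {true} ∷ p⊑q) p≢q = in⊂in (⊑∧≢⇒⊂ p⊑q (p≢q ∘ cong (inside ∷_)))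

minimal-nonface-unique : ∀ {n} (Δ : SimplicialComplex n) {H G : Subset n} →
  MinimalNonFace Δ H → G ⊑ H → face Δ G ≡ false → G ≡ H
minimal-nonface-unique Δ {H} {G} (_ , proper-faces) G⊑H G-nonface with ≡-dec Bool._≟_ G H
... | yes G≡H = G≡H
... | no G≢H = contradiction (trans (sym G-nonface) (proper-faces G (⊑∧≢⇒⊂ G⊑H G≢H))) λ ()

numberOf : {A : Set} → (A → Bool) → List A → ℕ
numberOf b xs = length (filter (λ x → b x Bool.≟ true) xs)

numberOf-++ : {A : Set} (b : A → Bool) (xs ys : List A) →
  numberOf b (xs ++ ys) ≡ numberOf b xs + numberOf b ys
numberOf-++ b xs ys =
  trans (cong length (filter-++ (λ x → b x Bool.≟ true) xs ys)) (length-++ (filter (λ x → b x Bool.≟ true) xs))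

numberOf-map : {A C : Set} (b : C → Bool) (f : A → C) (xs : List A) →
  numberOf b (map f xs) ≡ numberOf (b ∘ f) xs
numberOf-map b f [] = refl
numberOf-map b f (x ∷ xs) with b (f x)
... | true = cong suc (numberOf-map b f xs)
... | false = numberOf-map b f xs

numberOf-never : {A : Set} (b : A → Bool) → (∀ x → b x ≡ false) → (xs : List A) → numberOf b xs ≡ 0
numberOf-never b never [] = refl
numberOf-never b never (x ∷ xs) rewrite never x = numberOf-never b never xs

numberOf-allSubsets : ∀ n (b : Subset (suc n) → Bool) →
  numberOf b (allSubsets (suc n)) ≡
    numberOf (b ∘ (inside ∷_)) (allSubsets n) + numberOf (b ∘ (outside ∷_)) (allSubsets n)
numberOf-allSubsets n b =
  trans (numberOf-++ b (map (inside ∷_) (allSubsets n)) _)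
        (cong₂ _+_ (numberOf-map b _ (allSubsets n)) (numberOf-map b _ (allSubsets n)))

sized : ∀ n → (Subset n → Bool) → ℕ → ℕ
sized zero P zero = if P [] then 1 else 0
sized zero P (suc k) = 0
sized (suc n) P zero = sized n (P ∘ (outside ∷_)) zero
sized (suc n) P (suc k) = sized n (P ∘ (inside ∷_)) k + sized n (P ∘ (outside ∷_)) (suc k)

numberOf-sized : ∀ n (P : Subset n → Bool) k →
  numberOf (λ F → P F ∧ (∣ F ∣ ≡ᵇ k)) (allSubsets n) ≡ sized n P k
numberOf-sized zero P zero with P []
... | true = refl
... | false = refl
numberOf-sized zero P (suc k) with P []
... | true = refl
... | false = refl
numberOf-sized (suc n) P zero =
  trans (numberOf-allSubsets n _)
        (cong₂ _+_ (numberOf-never _ (λ F → ∧-zeroʳ (P (inside ∷ F))) (allSubsets n))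
                   (numberOf-sized n _ zero))
numberOf-sized (suc n) P (suc k) =
  trans (numberOf-allSubsets n _) (cong₂ _+_ (numberOf-sized n _ k) (numberOf-sized n _ (suc k)))

fCoeff-sized : ∀ {n} (Δ : SimplicialComplex n) k → fCoeff Δ k ≡ sized n (face Δ) k
fCoeff-sized {n} Δ = numberOf-sized n (face Δ)

sized-ext : ∀ n {P Q : Subset n → Bool} → (∀ F → P F ≡ Q F) → ∀ k → sized n P k ≡ sized n Q k
sized-ext zero P≗Q zero = cong (λ b → if b then 1 else 0) (P≗Q [])
sized-ext zero P≗Q (suc k) = refl
sized-ext (suc n) P≗Q zero = sized-ext n (P≗Q ∘ (outside ∷_)) zero
sized-ext (suc n) P≗Q (suc k) =
  cong₂ _+_ (sized-ext n (P≗Q ∘ (inside ∷_)) k) (sized-ext n (P≗Q ∘ (outside ∷_)) (suc k))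

sized-never : ∀ n k → sized n (λ _ → false) k ≡ 0
sized-never zero zero = refl
sized-never zero (suc k) = refl
sized-never (suc n) zero = sized-never n zero
sized-never (suc n) (suc k) = cong₂ _+_ (sized-never n k) (sized-never n (suc k))

occupied : ∀ {a} → Subset a → Bool
occupied [] = false
occupied (x ∷ B) = x ∨ occupied B

atMostOne : ∀ {a} → Subset a → Bool
atMostOne [] = true
atMostOne (true ∷ B) = not (occupied B)
atMostOne (false ∷ B) = atMostOne B

atMostOne-unoccupied : ∀ {a} (B : Subset a) → occupied B ≡ false → atMostOne B ≡ true
atMostOne-unoccupied [] _ = refl
atMostOne-unoccupied (false ∷ B) e = atMostOne-unoccupied B e

occupied-⊥ : ∀ a → occupied (⊥ {a}) ≡ false
occupied-⊥ zero = refl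
occupied-⊥ (suc a) = occupied-⊥ a

atMostOne-⊥ : ∀ a → atMostOne (⊥ {a}) ≡ true
atMostOne-⊥ a = atMostOne-unoccupied (⊥ {a}) (occupied-⊥ a)

occupied-mono : ∀ {a} {B C : Subset a} → B ⊑ C → occupied B Bool.≤ occupied C
occupied-mono [] = Bool.b≤b
occupied-mono {B = false ∷ B} (Bool.f≤t ∷ _) = ≤-maximum (occupied B)
occupied-mono (Bool.b≤b {true} ∷ _) = Bool.b≤b
occupied-mono (Bool.b≤b {false} ∷ B⊑C) = occupied-mono B⊑C

atMostOne-mono : ∀ {a} {B C : Subset a} → B ⊑ C → atMostOne C ≡ true → atMostOne B ≡ true
atMostOne-mono [] _ = refl
atMostOne-mono (_∷_ {ys = C} Bool.f≤t B⊑C) e = atMostOne-mono B⊑C (atMostOne-unoccupied C (not-true e))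
atMostOne-mono (Bool.b≤b {true} ∷ B⊑C) e = cong not (≤-false (occupied-mono B⊑C) (not-true e))
atMostOne-mono (Bool.b≤b {false} ∷ B⊑C) e = atMostOne-mono B⊑C e

singleton-in : ∀ {a} (B : Subset a) → occupied B ≡ true →
  ∃ λ B′ → B′ ⊑ B × ∣ B′ ∣ ≡ 1 × occupied B′ ≡ true
singleton-in {suc a} (true ∷ B) _ = true ∷ ⊥ , Bool.b≤b ∷ ⊆⇒⊑ ⊥⊆ , cong suc (∣⊥∣≡0 a) , refl
singleton-in (false ∷ B) e with singleton-in B e
... | B′ , B′⊑B , size , occ = false ∷ B′ , Bool.b≤b ∷ B′⊑B , size , occ

pair-in : ∀ {a} (B : Subset a) → atMostOne B ≡ false →
  ∃ λ B′ → B′ ⊑ B × ∣ B′ ∣ ≡ 2 × atMostOne B′ ≡ false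
pair-in (true ∷ B) e with singleton-in B (not-false e)
... | B′ , B′⊑B , size , occ = true ∷ B′ , Bool.b≤b ∷ B′⊑B , cong suc size , cong not occ
pair-in (false ∷ B) e with pair-in B e
... | B′ , B′⊑B , size , two = false ∷ B′ , Bool.b≤b ∷ B′⊑B , size , two

card-++ : ∀ {a r} (X : Subset a) (Y : Subset r) → ∣ X ++ᵛ Y ∣ ≡ ∣ X ∣ + ∣ Y ∣
card-++ [] Y = refl
card-++ (true ∷ X) Y = cong suc (card-++ X Y)
card-++ (false ∷ X) Y = card-++ X Y

card-take-drop : ∀ a {r} (G : Subset (a + r)) → ∣ G ∣ ≡ ∣ take a G ∣ + ∣ drop a G ∣
card-take-drop a G = trans (cong ∣_∣ (sym (take++drop≡id a G))) (card-++ (take a G) (drop a G))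

card-atMostOne : ∀ {a} (B : Subset a) → atMostOne B ≡ true → ∣ B ∣ ≡ ∣ occupied B ∷ [] ∣
card-atMostOne [] _ = refl
card-atMostOne (true ∷ B) e =
  cong suc (trans (card-atMostOne B (atMostOne-unoccupied B (not-true e))) (cong (λ b → ∣ b ∷ [] ∣) (not-true e)))
card-atMostOne (false ∷ B) e = card-atMostOne B e

take-++ : ∀ {a r} (X : Subset a) (Y : Subset r) → take a (X ++ᵛ Y) ≡ X
take-++ [] Y = refl
take-++ (x ∷ X) Y = cong (x ∷_) (take-++ X Y)

drop-++ : ∀ {a r} (X : Subset a) (Y : Subset r) → drop a (X ++ᵛ Y) ≡ Y
drop-++ [] Y = refl
drop-++ (x ∷ X) Y = drop-++ X Y

take-⊥ : ∀ a r → take a (⊥ {a + r}) ≡ ⊥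
take-⊥ zero r = refl
take-⊥ (suc a) r = cong (outside ∷_) (take-⊥ a r)

drop-⊥ : ∀ a r → drop a (⊥ {a + r}) ≡ ⊥
drop-⊥ zero r = refl
drop-⊥ (suc a) r = drop-⊥ a r

take-⊑ : ∀ a {r} {G F : Subset (a + r)} → G ⊑ F → take a G ⊑ take a F
take-⊑ zero _ = []
take-⊑ (suc a) (x≤y ∷ G⊑F) = x≤y ∷ take-⊑ a G⊑F

drop-⊑ : ∀ a {r} {G F : Subset (a + r)} → G ⊑ F → drop a G ⊑ drop a F
drop-⊑ zero G⊑F = G⊑F
drop-⊑ (suc a) (_ ∷ G⊑F) = drop-⊑ a G⊑F

join-⊑ : ∀ a {r} {X : Subset a} {Y : Subset r} (H : Subset (a + r)) →
  X ⊑ take a H → Y ⊑ drop a H → (X ++ᵛ Y) ⊑ H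
join-⊑ a {X = X} {Y} H X⊑ Y⊑ = subst ((X ++ᵛ Y) ⊑_) (take++drop≡id a H) (++⁺ X⊑ Y⊑)

-- blockThen a P₀ P₁: the first block holds at most one vertex; the rest
-- satisfies P₀ if the block is empty and P₁ if it is occupied.  It is
-- defined by scanning the block, which makes it easy to count.
blockThen : ∀ a {r} → (Subset r → Bool) → (Subset r → Bool) → Subset (a + r) → Bool
blockThen zero P₀ P₁ G = P₀ G
blockThen (suc a) P₀ P₁ (true ∷ G) = blockThen a P₁ (λ _ → false) G
blockThen (suc a) P₀ P₁ (false ∷ G) = blockThen a P₀ P₁ G

blockThen-spec : ∀ a {r} (P₀ P₁ : Subset r → Bool) (G : Subset (a + r)) →
  blockThen a P₀ P₁ G ≡
    atMostOne (take a G) ∧ (if occupied (take a G) then P₁ (drop a G) else P₀ (drop a G))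
blockThen-spec zero P₀ P₁ G = refl
blockThen-spec (suc a) P₀ P₁ (false ∷ G) = blockThen-spec a P₀ P₁ G
blockThen-spec (suc a) P₀ P₁ (true ∷ G) =
  trans (blockThen-spec a P₁ (λ _ → false) G) (at-most-one-then-empty (take a G))
  where
    -- once a vertex has been seen, the rest of the block must be empty
    at-most-one-then-empty : ∀ {b} (B : Subset b) →
      atMostOne B ∧ (if occupied B then false else P₁ (drop a G)) ≡ not (occupied B) ∧ P₁ (drop a G)
    at-most-one-then-empty [] = refl
    at-most-one-then-empty (true ∷ B) = ∧-zeroʳ (not (occupied B))
    at-most-one-then-empty (false ∷ B) = at-most-one-then-empty B

count-block-zero : ∀ a {r} (P₀ P₁ : Subset r → Bool) → sized (a + r) (blockThen a P₀ P₁) 0 ≡ sized r P₀ 0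
count-block-zero zero P₀ P₁ = refl
count-block-zero (suc a) P₀ P₁ = count-block-zero a P₀ P₁

-- Each of the a choices for the vertex in the block contributes a copy of
-- the (k-1)-sets satisfying P₁.
count-block-suc : ∀ a {r} (P₀ P₁ : Subset r → Bool) k →
  sized (a + r) (blockThen a P₀ P₁) (suc k) ≡ sized r P₀ (suc k) + a * sized r P₁ k

count-block-empty : ∀ a {r} (P : Subset r → Bool) k → sized (a + r) (blockThen a P (λ _ → false)) k ≡ sized r P k

count-block-suc zero P₀ P₁ k = sym (+-identityʳ _)
count-block-suc (suc a) {r} P₀ P₁ k = begin
    sized (a + r) (blockThen a P₁ (λ _ → false)) k + sized (a + r) (blockThen a P₀ P₁) (suc k)
  ≡⟨ cong₂ _+_ (count-block-empty a P₁ k) (count-block-suc a P₀ P₁ k) ⟩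
    sized r P₁ k + (sized r P₀ (suc k) + a * sized r P₁ k)
  ≡⟨ x∙yz≈y∙xz (sized r P₁ k) (sized r P₀ (suc k)) (a * sized r P₁ k) ⟩
    sized r P₀ (suc k) + suc a * sized r P₁ k ∎
  where open ≡-Reasoning

count-block-empty a P zero = count-block-zero a P _
count-block-empty a {r} P (suc k) = begin
    sized (a + r) (blockThen a P (λ _ → false)) (suc k)
  ≡⟨ count-block-suc a P _ k ⟩
    sized r P (suc k) + a * sized r (λ _ → false) k
  ≡⟨ cong (λ c → sized r P (suc k) + a * c) (sized-never r k) ⟩
    sized r P (suc k) + a * 0
  ≡⟨ cong (sized r P (suc k) +_) (*-zeroʳ a) ⟩
    sized r P (suc k) + 0
  ≡⟨ +-identityʳ _ ⟩
    sized r P (suc k) ∎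
  where open ≡-Reasoning

-- The inflation.  Fin (n * m) = Fin (m + (n-1) * m) is read as n blocks of
-- m vertices; block i consists of the m copies of vertex i of Γ.

module Inflation (m : ℕ) where

  transversal : ∀ n → Subset (n * m) → Bool
  transversal zero G = true
  transversal (suc n) G = atMostOne (take m G) ∧ transversal n (drop m G)

  shadow : ∀ n → Subset (n * m) → Subset n
  shadow zero G = []
  shadow (suc n) G = occupied (take m G) ∷ shadow n (drop m G)

  inflate : ∀ n → (Subset n → Bool) → Subset (n * m) → Bool
  inflate n P G = transversal n G ∧ P (shadow n G)

  transversal-++ : ∀ n (X : Subset m) (Y : Subset (n * m)) →
    transversal (suc n) (X ++ᵛ Y) ≡ atMostOne X ∧ transversal n Y
  transversal-++ n X Y = cong₂ (λ B R → atMostOne B ∧ transversal n R) (take-++ X Y) (drop-++ X Y)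

  shadow-++ : ∀ n (X : Subset m) (Y : Subset (n * m)) → shadow (suc n) (X ++ᵛ Y) ≡ occupied X ∷ shadow n Y
  shadow-++ n X Y = cong₂ (λ B R → occupied B ∷ shadow n R) (take-++ X Y) (drop-++ X Y)

  inflate-block : ∀ n (P : Subset (suc n) → Bool) (G : Subset (suc n * m)) →
    inflate (suc n) P G ≡ blockThen m (inflate n (P ∘ (outside ∷_))) (inflate n (P ∘ (inside ∷_))) G
  inflate-block n P G = begin
      (atMostOne B ∧ transversal n R) ∧ P (occupied B ∷ shadow n R)
    ≡⟨ ∧-assoc (atMostOne B) _ _ ⟩
      atMostOne B ∧ (transversal n R ∧ P (occupied B ∷ shadow n R))
    ≡⟨ cong (atMostOne B ∧_) (by-occupancy (occupied B)) ⟩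
      atMostOne B ∧ (if occupied B then inflate n (P ∘ (inside ∷_)) R else inflate n (P ∘ (outside ∷_)) R)
    ≡⟨ sym (blockThen-spec m _ _ G) ⟩
      blockThen m (inflate n (P ∘ (outside ∷_))) (inflate n (P ∘ (inside ∷_))) G ∎
    where
      open ≡-Reasoning
      B = take m G
      R = drop m G
      by-occupancy : ∀ b → transversal n R ∧ P (b ∷ shadow n R) ≡
        (if b then inflate n (P ∘ (inside ∷_)) R else inflate n (P ∘ (outside ∷_)) R)
      by-occupancy true = refl
      by-occupancy false = refl

  -- Every k-set satisfying P has m^k transversal lifts.
  count-inflate : ∀ n (P : Subset n → Bool) k → sized (n * m) (inflate n P) k ≡ m ^ k * sized n P k
  count-inflate zero P zero = sym (*-identityˡ _)
  count-inflate zero P (suc k) = sym (*-zeroʳ (m ^ suc k))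
  count-inflate (suc n) P zero = begin
      sized (suc n * m) (inflate (suc n) P) 0
    ≡⟨ sized-ext (suc n * m) (inflate-block n P) 0 ⟩
      sized (m + n * m) (blockThen m (inflate n P₀) (inflate n P₁)) 0
    ≡⟨ count-block-zero m _ _ ⟩
      sized (n * m) (inflate n P₀) 0
    ≡⟨ count-inflate n P₀ 0 ⟩
      1 * sized (suc n) P 0 ∎
    where
      open ≡-Reasoning
      P₀ = P ∘ (outside ∷_)
      P₁ = P ∘ (inside ∷_)
  count-inflate (suc n) P (suc k) = begin
      sized (suc n * m) (inflate (suc n) P) (suc k)
    ≡⟨ sized-ext (suc n * m) (inflate-block n P) (suc k) ⟩
      sized (m + n * m) (blockThen m (inflate n P₀) (inflate n P₁)) (suc k)
    ≡⟨ count-block-suc m _ _ k ⟩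
      sized (n * m) (inflate n P₀) (suc k) + m * sized (n * m) (inflate n P₁) k
    ≡⟨ cong₂ (λ x y → x + m * y) (count-inflate n P₀ (suc k)) (count-inflate n P₁ k) ⟩
      m ^ suc k * A + m * (m ^ k * C)
    ≡⟨ cong (m ^ suc k * A +_) (sym (*-assoc m (m ^ k) C)) ⟩
      m ^ suc k * A + m ^ suc k * C
    ≡⟨ sym (*-distribˡ-+ (m ^ suc k) A C) ⟩
      m ^ suc k * (A + C)
    ≡⟨ cong (m ^ suc k *_) (+-comm A C) ⟩
      m ^ suc k * sized (suc n) P (suc k) ∎
    where
      open ≡-Reasoning
      P₀ = P ∘ (outside ∷_)
      P₁ = P ∘ (inside ∷_)
      A = sized n P₀ (suc k)
      C = sized n P₁ k

  transversal-⊥ : ∀ n → transversal n ⊥ ≡ true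
  transversal-⊥ zero = refl
  transversal-⊥ (suc n) =
    trans (cong₂ (λ B R → atMostOne B ∧ transversal n R) (take-⊥ m (n * m)) (drop-⊥ m (n * m)))
          (cong₂ _∧_ (atMostOne-⊥ m) (transversal-⊥ n))

  shadow-⊥ : ∀ n → shadow n ⊥ ≡ ⊥
  shadow-⊥ zero = refl
  shadow-⊥ (suc n) =
    trans (cong₂ (λ B R → occupied B ∷ shadow n R) (take-⊥ m (n * m)) (drop-⊥ m (n * m)))
          (cong₂ _∷_ (occupied-⊥ m) (shadow-⊥ n))

  transversal-mono : ∀ n {G F : Subset (n * m)} → G ⊑ F → transversal n F ≡ true → transversal n G ≡ true
  transversal-mono zero _ _ = refl
  transversal-mono (suc n) G⊑F e =
    ∧-true (atMostOne-mono (take-⊑ m G⊑F) (∧-conicalˡ _ _ e)) (transversal-mono n (drop-⊑ m G⊑F) (∧-conicalʳ _ _ e))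

  shadow-mono : ∀ n {G F : Subset (n * m)} → G ⊑ F → shadow n G ⊑ shadow n F
  shadow-mono zero _ = []
  shadow-mono (suc n) G⊑F = occupied-mono (take-⊑ m G⊑F) ∷ shadow-mono n (drop-⊑ m G⊑F)

  card-shadow : ∀ n (H : Subset (n * m)) → transversal n H ≡ true → ∣ H ∣ ≡ ∣ shadow n H ∣
  card-shadow zero [] _ = refl
  card-shadow (suc n) H e = begin
      ∣ H ∣
    ≡⟨ card-take-drop m H ⟩
      ∣ take m H ∣ + ∣ drop m H ∣
    ≡⟨ cong₂ _+_ (card-atMostOne (take m H) (∧-conicalˡ _ _ e)) (card-shadow n (drop m H) (∧-conicalʳ _ _ e)) ⟩
      ∣ occupied (take m H) ∷ [] ∣ + ∣ shadow n (drop m H) ∣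
    ≡⟨ sym (card-++ (occupied (take m H) ∷ []) (shadow n (drop m H))) ⟩
      ∣ shadow (suc n) H ∣ ∎
    where open ≡-Reasoning

  nontransversal-pair : ∀ n (H : Subset (n * m)) → transversal n H ≡ false →
    ∃ λ H′ → H′ ⊑ H × ∣ H′ ∣ ≡ 2 × transversal n H′ ≡ false
  nontransversal-pair (suc n) H e with atMostOne (take m H) in first-block
  ... | false with pair-in (take m H) first-block
  ...   | B′ , B′⊑B , size , two =
          B′ ++ᵛ ⊥ , join-⊑ m H B′⊑B (⊆⇒⊑ ⊥⊆) ,
          trans (card-++ B′ ⊥) (cong₂ _+_ size (∣⊥∣≡0 (n * m))) ,
          trans (transversal-++ n B′ ⊥) (cong (_∧ transversal n ⊥) two)
  nontransversal-pair (suc n) H e | true with nontransversal-pair n (drop m H) e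
  ...   | R′ , R′⊑R , size , bad =
          ⊥ {m} ++ᵛ R′ , join-⊑ m H (⊆⇒⊑ ⊥⊆) R′⊑R ,
          trans (card-++ (⊥ {m}) R′) (cong₂ _+_ (∣⊥∣≡0 m) size) ,
          trans (transversal-++ n ⊥ R′) (cong₂ _∧_ (atMostOne-⊥ m) bad)

  restrict : ∀ n → Subset n → Subset (n * m) → Subset (n * m)
  restrict zero S G = G
  restrict (suc n) (b ∷ S) G = (if b then take m G else ⊥) ++ᵛ restrict n S (drop m G)

  restrict-⊑ : ∀ n (S : Subset n) (H : Subset (n * m)) → restrict n S H ⊑ H
  restrict-⊑ zero S H = ⊑-refl
  restrict-⊑ (suc n) (true ∷ S) H = join-⊑ m H (⊑-refl) (restrict-⊑ n S (drop m H))
  restrict-⊑ (suc n) (false ∷ S) H = join-⊑ m H (⊆⇒⊑ ⊥⊆) (restrict-⊑ n S (drop m H))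

  shadow-restrict : ∀ n (S : Subset n) (H : Subset (n * m)) → S ⊑ shadow n H → shadow n (restrict n S H) ≡ S
  shadow-restrict zero [] H _ = refl
  shadow-restrict (suc n) (true ∷ S) H S⊑ =
    trans (shadow-++ n _ _) (cong₂ _∷_ (occupied-true (⊑-head S⊑)) (shadow-restrict n S (drop m H) (⊑-tail S⊑)))
    where
      occupied-true : ∀ {c} → true Bool.≤ c → c ≡ true
      occupied-true Bool.b≤b = refl
  shadow-restrict (suc n) (false ∷ S) H S⊑ =
    trans (shadow-++ n _ _) (cong₂ _∷_ (occupied-⊥ m) (shadow-restrict n S (drop m H) (⊑-tail S⊑)))

  inflation : ∀ {n} → SimplicialComplex n → SimplicialComplex (n * m)
  inflation {n} Γ = record
    { face = inflate n (face Γ)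
    ; empty-face = cong₂ _∧_ (transversal-⊥ n) (trans (cong (face Γ) (shadow-⊥ n)) (empty-face Γ))
    ; down-closed = λ G⊆F e →
        ∧-true (transversal-mono n (⊆⇒⊑ G⊆F) (∧-conicalˡ _ _ e))
               (down-closed Γ (⊑⇒⊆ (shadow-mono n (⊆⇒⊑ G⊆F))) (∧-conicalʳ _ _ e))
    }

  inflation-scaled : ∀ {n} (Γ : SimplicialComplex n) → HasFPolyScaled (inflation Γ) m Γ
  inflation-scaled {n} Γ k =
    trans (fCoeff-sized (inflation Γ) k) (trans (count-inflate n (face Γ) k) (cong (m ^ k *_) (sym (fCoeff-sized Γ k))))

  minimal-nontransversal : ∀ {n} (Γ : SimplicialComplex n) {H} → MinimalNonFace (inflation Γ) H →
    transversal n H ≡ false → ∣ H ∣ ≡ 2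
  minimal-nontransversal {n} Γ {H} minimal bad with nontransversal-pair n H bad
  ... | H′ , H′⊑H , size , H′-bad =
    subst (λ X → ∣ X ∣ ≡ 2)
          (minimal-nonface-unique (inflation Γ) minimal H′⊑H (cong (_∧ face Γ (shadow n H′)) H′-bad)) size

  -- The shadow of a transversal minimal non-face is a minimal non-face of Γ:
  -- a proper subset S of the shadow is the shadow of 'restrict S H' ⊂ H.
  shadow-minimal : ∀ {n} (Γ : SimplicialComplex n) {H} → MinimalNonFace (inflation Γ) H →
    transversal n H ≡ true → MinimalNonFace Γ (shadow n H)
  shadow-minimal {n} Γ {H} (nonface , proper-faces) tr =
    trans (sym (cong (_∧ face Γ (shadow n H)) tr)) nonface , shadow-proper-faces
    where
      shadow-proper-faces : ∀ S → S ⊂ shadow n H → face Γ S ≡ true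
      shadow-proper-faces S S⊂ =
        subst (λ X → face Γ X ≡ true) shadow-R (∧-conicalʳ _ _ (proper-faces R (⊑∧≢⇒⊂ (restrict-⊑ n S H) R≢H)))
        where
          R = restrict n S H
          shadow-R : shadow n R ≡ S
          shadow-R = shadow-restrict n S H (⊆⇒⊑ (p⊂q⇒p⊆q S⊂))
          R≢H : R ≢ H
          R≢H R≡H = ⊂-irref (trans (sym shadow-R) (cong (shadow n) R≡H)) S⊂

  inflation-flag : ∀ {n} (Γ : SimplicialComplex n) → IsFlag Γ → IsFlag (inflation Γ)
  inflation-flag {n} Γ flag H minimal = by-transversality (transversal n H) refl
    where
      by-transversality : ∀ b → transversal n H ≡ b → ∣ H ∣ ≡ 2
      by-transversality false tr = minimal-nontransversal Γ minimal tr
      by-transversality true tr = trans (card-shadow n H tr) (flag (shadow n H) (shadow-minimal Γ minimal tr))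

-- The inflation by m realises f(mx); the construction needs no assumption on m.
proposition6p4 : ∀ {n} (Γ : SimplicialComplex n) → IsFlag Γ →
    ∀ (m : ℕ) → 1 ≤ m →
      ∃ λ (n' : ℕ) → Σ (SimplicialComplex n') λ Δ → IsFlag Δ × HasFPolyScaled Δ m Γ
proposition6p4 {n} Γ flag m _ = n * m , inflation Γ , inflation-flag Γ flag , inflation-scaled Γ
  where open Inflation m
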